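{- Let $T$ be a simple filter of a residuated lattice $L$. Then: (1) there exists a prime filter $P$ of $L$ such that $T\cap P=\{1\}$ (i.e. $\{T,P\}$ is an independent family); (2) if $\mathrm{Rad}(L)=\{1\}$, then $T$ is a direct summand of $L$, i.e. $L=T\oplus G$ for some filter $G$ of $L$.
   Context: A residuated lattice is an algebra $(L,\wedge,\vee,\odot,\rightarrow,0,1)$ such that $(L,\wedge,\vee,0,1)$ is a bounded lattice, $(L,\odot,1)$ is a commutative monoid, and $x\odot z\le y$ iff $z\le x\rightarrow y$. A filter is a nonempty subset closed under $\odot$ and upward closed; $F\vee G$ is the smallest filter containing $F\cup G$, and $L=F\oplus G$ means $F\cap G=\{1\}$ and $F\vee G=L$. A proper filter $P$ is prime if $x\vee y\in P$ implies $x\in P$ or $y\in P$. $\mathrm{Rad}(L)$ is the intersection of all maximal filters. A filter $T$ is simple if $T\neq\{1\}$ and the only filters contained in $T$ are $\{1\}$ and $T$. -}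

module Defs where

open import Level using (Level; _⊔_) renaming (suc to lsuc)
open import Data.Product using (Σ; ∃; _×_; _,_)
open import Data.Sum using (_⊎_)
open import Relation.Nullary using (¬_)
open import Relation.Unary using (Pred; _∈_; _∉_; _⊆_)
open import Relation.Binary.PropositionalEquality using (_≡_)
open import Algebra.Core using (Op₂)
open import Algebra.Structures using (IsCommutativeMonoid)
open import Algebra.Lattice.Structures using (IsLattice)

record ResiduatedLattice (a : Level) : Set (lsuc a) where
  infixr 7 _∧_
  infixr 6 _∨_
  infixr 7 _⊙_
  infixr 5 _⇒_
  infix  4 _≤_
  field
    Carrier : Set a
    _∧_ _∨_ _⊙_ _⇒_ : Op₂ Carrier
    𝟘 𝟙 : Carrier
    isLattice            : IsLattice _≡_ _∨_ _∧_
    ⊙-isCommutativeMonoid : IsCommutativeMonoid _≡_ _⊙_ 𝟙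

  _≤_ : Carrier → Carrier → Set a
  x ≤ y = x ∧ y ≡ x

  field
    𝟘-least    : ∀ x → 𝟘 ≤ x
    𝟙-greatest : ∀ x → x ≤ 𝟙
    residuation-⇒ : ∀ x y z → x ⊙ z ≤ y → z ≤ x ⇒ y
    residuation-⇐ : ∀ x y z → z ≤ x ⇒ y → x ⊙ z ≤ y

module _ {a : Level} (L : ResiduatedLattice a) where
  open ResiduatedLattice L

  Subset : Set (lsuc a)
  Subset = Pred Carrier a

  IsTrivial : Subset → Set a
  IsTrivial F = ∀ x → (x ∈ F → x ≡ 𝟙) × (x ≡ 𝟙 → x ∈ F)

  MeetIsTrivial : Subset → Subset → Set a
  MeetIsTrivial F G = ∀ x → (x ∈ F × x ∈ G → x ≡ 𝟙) × (x ≡ 𝟙 → x ∈ F × x ∈ G)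

  record IsFilter (F : Subset) : Set a where
    field
      nonempty : ∃ λ x → x ∈ F
      ⊙-closed : ∀ {x y} → x ∈ F → y ∈ F → x ⊙ y ∈ F
      upward   : ∀ {x y} → x ∈ F → x ≤ y → y ∈ F

  IsWhole : Subset → Set a
  IsWhole F = ∀ x → x ∈ F

  IsProperFilter : Subset → Set a
  IsProperFilter F = IsFilter F × ¬ IsWhole F

  -- F ∨ G = L: the smallest filter containing F ∪ G is L, i.e. every
  -- filter containing F and G is the whole of L.
  JoinIsWhole : Subset → Subset → Set (lsuc a)
  JoinIsWhole F G = ∀ (K : Subset) → IsFilter K → F ⊆ K → G ⊆ K → IsWhole K

  DirectSum : Subset → Subset → Set (lsuc a)
  DirectSum F G = MeetIsTrivial F G × JoinIsWhole F G

  record IsPrimeFilter (P : Subset) : Set a where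
    field
      proper : IsProperFilter P
      prime  : ∀ {x y} → x ∨ y ∈ P → x ∈ P ⊎ y ∈ P

  IsMaximalFilter : Subset → Set (lsuc a)
  IsMaximalFilter M =
    IsProperFilter M × (∀ (G : Subset) → IsProperFilter G → M ⊆ G → G ⊆ M)

  Rad : Pred Carrier (lsuc a)
  Rad x = ∀ (M : Subset) → IsMaximalFilter M → x ∈ M

  RadIsTrivial : Set (lsuc a)
  RadIsTrivial = ∀ x → (x ∈ Rad → x ≡ 𝟙) × (x ≡ 𝟙 → x ∈ Rad)

  IsSimpleFilter : Subset → Set (lsuc a)
  IsSimpleFilter T =
    IsFilter T × ¬ IsTrivial T ×
    (∀ (G : Subset) → IsFilter G → G ⊆ T → IsTrivial G ⊎ (T ⊆ G))

ZornsLemma : (ℓ₁ ℓ₂ ℓ₃ : Level) → Set (lsuc (ℓ₁ ⊔ ℓ₂ ⊔ ℓ₃))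
ZornsLemma ℓ₁ ℓ₂ ℓ₃ =
  ∀ (A : Set ℓ₁) (_≼_ : A → A → Set ℓ₂) →
  (∀ x → x ≼ x) → (∀ {x y z} → x ≼ y → y ≼ z → x ≼ z) →
  (∀ (C : Pred A ℓ₃) → (∀ {x y} → x ∈ C → y ∈ C → x ≼ y ⊎ y ≼ x) →
     ∃ λ u → ∀ {x} → x ∈ C → x ≼ u) →
  ∃ λ m → ∀ x → m ≼ x → x ≼ m

{-# OPTIONS --safe #-}
module Submission where

-- Pick t ∈ T with t ≠ 1. Because T is simple, every filter G avoiding t meets T
-- only in 1. By Zorn there is a filter P maximal among those avoiding t, and such a
-- P is prime: if x, y ∉ P then t lies in the filters generated by P ∪ {x} and by
-- P ∪ {y}, i.e. p ⊙ xⁿ ≤ t and q ⊙ yᵏ ≤ t with p, q ∈ P, whence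
-- (p ⊙ q) ⊙ (x ∨ y)ⁿ⁺ᵏ ≤ t, so x ∨ y ∉ P. If Rad(L) = {1}, some maximal filter M
-- avoids t; then T ∩ M = {1}, and any filter containing T and M contains t ∉ M,
-- so by maximality it is not proper.

open import Defs
open import Level using (Level; Lift; lift; lower) renaming (suc to lsuc)
open import Data.Product using (∃; ∃-syntax; _×_; _,_; proj₁; proj₂)
open import Data.Sum using (_⊎_; inj₁; inj₂)
open import Data.Nat using (ℕ; zero; suc; _+_)
open import Data.Nat.Properties using (+-suc)
open import Relation.Nullary using (yes; no; contradiction)
open import Relation.Nullary.Decidable using (True; toWitness; fromWitness)
open import Relation.Unary using (Pred; _∈_; _∉_; _⊆_; _∩_)
open import Relation.Binary.PropositionalEquality
  using (_≡_; _≢_; refl; sym; trans; cong; subst; isEquivalence)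
open import Relation.Binary.Bundles using (Poset)
open import Relation.Binary.Structures using (IsPartialOrder)
open import Algebra.Bundles using (CommutativeMonoid)
open import Algebra.Lattice.Bundles using (Lattice)
open import Axiom.ExcludedMiddle using (ExcludedMiddle)
open import Axiom.DoubleNegationElimination using (DoubleNegationElimination; em⇒dne)
import Algebra.Lattice.Properties.Lattice as LatticeProperties
import Algebra.Properties.CommutativeSemigroup as CommutativeSemigroupProperties
import Relation.Binary.Lattice as OrderTheoretic

module Properties {a : Level} (L : ResiduatedLattice a) where
  open ResiduatedLattice L

  private
    variable
      x y z t w : Carrier
      F G T : Subset L

  lattice : Lattice a a
  lattice = record
    { Carrier = Carrier ; _≈_ = _≡_ ; _∨_ = _∨_ ; _∧_ = _∧_ ; isLattice = isLattice }

  ⊙-commutativeMonoid : CommutativeMonoid a a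
  ⊙-commutativeMonoid = record
    { Carrier = Carrier ; _≈_ = _≡_ ; _∙_ = _⊙_ ; ε = 𝟙
    ; isCommutativeMonoid = ⊙-isCommutativeMonoid }

  open CommutativeMonoid ⊙-commutativeMonoid public
    using (assoc; comm; identityˡ; identityʳ; commutativeSemigroup)
  open CommutativeSemigroupProperties commutativeSemigroup using (xy∙z≈x∙zy; xy∙z≈xz∙y)

  -- The library orders a lattice by x ≡ x ∧ y, Defs by x ∧ y ≡ x: hence the syms.
  private
    module Std = OrderTheoretic.Lattice (LatticeProperties.∨-∧-orderTheoreticLattice lattice)

  ≤-isPartialOrder : IsPartialOrder _≡_ _≤_
  ≤-isPartialOrder = record
    { isPreorder = record
      { isEquivalence = isEquivalence
      ; reflexive     = λ x≡y → sym (Std.reflexive x≡y)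
      ; trans         = λ x≤y y≤z → sym (Std.trans (sym x≤y) (sym y≤z))
      }
    ; antisym = λ x≤y y≤x → Std.antisym (sym x≤y) (sym y≤x)
    }

  ≤-poset : Poset a a a
  ≤-poset = record { isPartialOrder = ≤-isPartialOrder }

  open Poset ≤-poset public using ()
    renaming (refl to ≤-refl; reflexive to ≤-reflexive; trans to ≤-trans; antisym to ≤-antisym)

  ∨-least : x ≤ z → y ≤ z → x ∨ y ≤ z
  ∨-least x≤z y≤z = sym (Std.∨-least (sym x≤z) (sym y≤z))

  ⊙-monoʳ-≤ : x ≤ y → z ⊙ x ≤ z ⊙ y
  ⊙-monoʳ-≤ {x} {y} {z} x≤y =
    residuation-⇐ z (z ⊙ y) x (≤-trans x≤y (residuation-⇒ z (z ⊙ y) y ≤-refl))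

  ⊙-monoˡ-≤ : x ≤ y → x ⊙ z ≤ y ⊙ z
  ⊙-monoˡ-≤ {x} {y} {z} x≤y =
    subst (_≤ y ⊙ z) (comm z x) (subst (z ⊙ x ≤_) (comm z y) (⊙-monoʳ-≤ x≤y))

  x⊙y≤x : x ⊙ y ≤ x
  x⊙y≤x {x} {y} = subst (x ⊙ y ≤_) (identityʳ x) (⊙-monoʳ-≤ (𝟙-greatest y))

  x⊙y≤y : x ⊙ y ≤ y
  x⊙y≤y {x} {y} = subst (x ⊙ y ≤_) (identityˡ y) (⊙-monoˡ-≤ (𝟙-greatest x))

  ⊙-∨-least : ∀ {c x y t} → c ⊙ x ≤ t → c ⊙ y ≤ t → c ⊙ (x ∨ y) ≤ t
  ⊙-∨-least {c} {x} {y} {t} cx≤t cy≤t =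
    residuation-⇐ c t (x ∨ y) (∨-least (residuation-⇒ c t x cx≤t) (residuation-⇒ c t y cy≤t))

  infixr 8 _^_
  _^_ : Carrier → ℕ → Carrier
  x ^ zero  = 𝟙
  x ^ suc n = x ⊙ x ^ n

  ^-distribˡ-+-⊙ : ∀ x m n → x ^ (m + n) ≡ x ^ m ⊙ x ^ n
  ^-distribˡ-+-⊙ x zero    n = sym (identityˡ (x ^ n))
  ^-distribˡ-+-⊙ x (suc m) n =
    trans (cong (x ⊙_) (^-distribˡ-+-⊙ x m n)) (sym (assoc x (x ^ m) (x ^ n)))

  -- The multiplier c is what makes the induction go through: each step moves one
  -- factor x or y of (x ∨ y)ⁱ⁺ʲ into c.
  ⊙-∨-^-least : ∀ {c x y t} i j → c ⊙ x ^ i ≤ t → c ⊙ y ^ j ≤ t → c ⊙ (x ∨ y) ^ (i + j) ≤ t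
  ⊙-∨-^-least zero j c⊙𝟙≤t _ =
    ≤-trans x⊙y≤x (≤-trans (≤-reflexive (sym (identityʳ _))) c⊙𝟙≤t)
  ⊙-∨-^-least (suc i) zero _ c⊙𝟙≤t =
    ≤-trans x⊙y≤x (≤-trans (≤-reflexive (sym (identityʳ _))) c⊙𝟙≤t)
  ⊙-∨-^-least {c} {x} {y} {t} (suc i) (suc j) cxⁱ⁺¹≤t cyʲ⁺¹≤t =
    subst (_≤ t) (xy∙z≈x∙zy c e (x ∨ y)) (⊙-∨-least cex≤t cey≤t)
    where
    e : Carrier
    e = (x ∨ y) ^ (i + suc j)

    cex≤t : (c ⊙ e) ⊙ x ≤ t
    cex≤t = subst (_≤ t) (xy∙z≈xz∙y c x e)
      (⊙-∨-^-least i (suc j) (subst (_≤ t) (sym (assoc c x (x ^ i))) cxⁱ⁺¹≤t)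
                              (≤-trans (⊙-monoˡ-≤ x⊙y≤x) cyʲ⁺¹≤t))

    cey≤t : (c ⊙ e) ⊙ y ≤ t
    cey≤t = subst (λ k → (c ⊙ (x ∨ y) ^ k) ⊙ y ≤ t) (sym (+-suc i j))
      (subst (_≤ t) (xy∙z≈xz∙y c y _)
        (⊙-∨-^-least (suc i) j (≤-trans (⊙-monoˡ-≤ x⊙y≤x) cxⁱ⁺¹≤t)
                               (subst (_≤ t) (sym (assoc c y (y ^ j))) cyʲ⁺¹≤t)))

  𝟙∈filter : IsFilter L F → 𝟙 ∈ F
  𝟙∈filter F-filter = upward (proj₂ nonempty) (𝟙-greatest _)
    where open IsFilter F-filter

  ^-closed : IsFilter L F → ∀ n → x ∈ F → x ^ n ∈ F
  ^-closed F-filter zero    _   = 𝟙∈filter F-filter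
  ^-closed F-filter (suc n) x∈F = IsFilter.⊙-closed F-filter x∈F (^-closed F-filter n x∈F)

  ∩-isFilter : IsFilter L F → IsFilter L G → IsFilter L (F ∩ G)
  ∩-isFilter F-filter G-filter = record
    { nonempty = 𝟙 , 𝟙∈filter F-filter , 𝟙∈filter G-filter
    ; ⊙-closed = λ (x∈F , x∈G) (y∈F , y∈G) → F.⊙-closed x∈F y∈F , G.⊙-closed x∈G y∈G
    ; upward   = λ (x∈F , x∈G) x≤y → F.upward x∈F x≤y , G.upward x∈G x≤y
    }
    where
    module F = IsFilter F-filter
    module G = IsFilter G-filter

  adjoin : Subset L → Carrier → Subset L
  adjoin F x w = ∃[ p ] ∃[ n ] p ∈ F × p ⊙ x ^ n ≤ w

  adjoin-isFilter : IsFilter L F → IsFilter L (adjoin F x)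
  adjoin-isFilter {F} {x} F-filter = record
    { nonempty = 𝟙 , 𝟙 , 0 , 𝟙∈filter F-filter , 𝟙-greatest _
    ; ⊙-closed = ⊙-closed′
    ; upward   = λ (p , n , p∈F , pxⁿ≤w) w≤w′ → p , n , p∈F , ≤-trans pxⁿ≤w w≤w′
    }
    where
    open IsFilter F-filter
    open CommutativeSemigroupProperties commutativeSemigroup using (interchange)

    ⊙-closed′ : w ∈ adjoin F x → z ∈ adjoin F x → w ⊙ z ∈ adjoin F x
    ⊙-closed′ {w} {z} (p , n , p∈F , pxⁿ≤w) (q , m , q∈F , qxᵐ≤z) =
      p ⊙ q , n + m , ⊙-closed p∈F q∈F ,
      subst (_≤ w ⊙ z)
        (sym (trans (cong ((p ⊙ q) ⊙_) (^-distribˡ-+-⊙ x n m)) (interchange p q (x ^ n) (x ^ m))))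
        (≤-trans (⊙-monoˡ-≤ pxⁿ≤w) (⊙-monoʳ-≤ qxᵐ≤z))

  ⊆-adjoin : F ⊆ adjoin F x
  ⊆-adjoin p∈F = _ , 0 , p∈F , ≤-reflexive (identityʳ _)

  x∈adjoin : IsFilter L F → x ∈ adjoin F x
  x∈adjoin F-filter = 𝟙 , 1 , 𝟙∈filter F-filter , ≤-reflexive (trans (identityˡ _) (identityʳ _))

  adjoin-∩-⊆ : IsFilter L F → x ∨ y ∈ F → adjoin F x ∩ adjoin F y ⊆ F
  adjoin-∩-⊆ F-filter x∨y∈F ((p , n , p∈F , pxⁿ≤w) , (q , k , q∈F , qyᵏ≤w)) =
    upward (⊙-closed (⊙-closed p∈F q∈F) (^-closed F-filter (n + k) x∨y∈F))
      (⊙-∨-^-least n k (≤-trans (⊙-monoˡ-≤ x⊙y≤x) pxⁿ≤w)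
                       (≤-trans (⊙-monoˡ-≤ x⊙y≤y) qyᵏ≤w))
    where open IsFilter F-filter

  IsMaximalAvoiding : Carrier → Subset L → Set (lsuc a)
  IsMaximalAvoiding t P =
    IsFilter L P × t ∉ P × (∀ G → IsFilter L G → t ∉ G → P ⊆ G → G ⊆ P)

  simple-meet-avoiding : IsSimpleFilter L T → t ∈ T → IsFilter L G → t ∉ G → MeetIsTrivial L T G
  simple-meet-avoiding (T-filter , _ , minimal) t∈T G-filter t∉G
    with minimal _ (∩-isFilter T-filter G-filter) proj₁
  ... | inj₁ T∩G-trivial = T∩G-trivial
  ... | inj₂ T⊆T∩G       = contradiction (proj₂ (T⊆T∩G t∈T)) t∉G

module Classical (lem : ∀ {ℓ} → ExcludedMiddle ℓ) {a : Level} (L : ResiduatedLattice a) where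
  open ResiduatedLattice L
  open Properties L

  private
    variable
      x t : Carrier
      F M P T : Subset L

  dne : ∀ {ℓ} → DoubleNegationElimination ℓ
  dne = em⇒dne lem

  maximalAvoiding⇒prime : IsMaximalAvoiding t P → IsPrimeFilter L P
  maximalAvoiding⇒prime {t} {P} (P-filter , t∉P , maximal) = record
    { proper = P-filter , λ P-whole → t∉P (P-whole t)
    ; prime  = prime
    }
    where
    t∈adjoin : x ∉ P → t ∈ adjoin P x
    t∈adjoin x∉P = dne λ t∉adjoin →
      x∉P (maximal _ (adjoin-isFilter P-filter) t∉adjoin ⊆-adjoin (x∈adjoin P-filter))

    prime : ∀ {x y} → x ∨ y ∈ P → x ∈ P ⊎ y ∈ P
    prime {x} {y} x∨y∈P with lem {P = x ∈ P} | lem {P = y ∈ P}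
    ... | yes x∈P | _       = inj₁ x∈P
    ... | no _    | yes y∈P = inj₂ y∈P
    ... | no x∉P  | no y∉P  =
      contradiction (adjoin-∩-⊆ P-filter x∨y∈P (t∈adjoin x∉P , t∈adjoin y∉P)) t∉P

  -- Excluded middle makes every proposition equivalent to one in Set₀ (whether its
  -- decision is yes). This is what lets the union of a chain of filters, a priori a
  -- predicate one level up, be a subset of L.
  Small : ∀ {ℓ} → Set ℓ → Set a
  Small X = Lift a (True (lem {P = X}))

  toSmall : ∀ {ℓ} {X : Set ℓ} → X → Small X
  toSmall x = lift (fromWitness x)

  fromSmall : ∀ {ℓ} {X : Set ℓ} → Small X → X
  fromSmall s = toWitness (lower s)

  record AvoidingFilter (t : Carrier) : Set (lsuc a) where
    field
      carrier  : Subset L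
      isFilter : IsFilter L carrier
      avoids   : t ∉ carrier

  open AvoidingFilter

  _≼_ : AvoidingFilter t → AvoidingFilter t → Set a
  F ≼ G = carrier F ⊆ carrier G

  IsChain : Pred (AvoidingFilter t) (lsuc a) → Set (lsuc a)
  IsChain C = ∀ {F G} → F ∈ C → G ∈ C → F ≼ G ⊎ G ≼ F

  module _ (C : Pred (AvoidingFilter t) (lsuc a)) (chain : IsChain C) where

    -- The disjunct w ≡ 𝟙 makes the union of the empty chain a filter.
    ⋃ : Subset L
    ⋃ w = Small (∃[ F ] F ∈ C × w ∈ carrier F) ⊎ w ≡ 𝟙

    ⋃-isFilter : IsFilter L ⋃
    ⋃-isFilter = record
      { nonempty = 𝟙 , inj₂ refl
      ; ⊙-closed = ⊙-closed
      ; upward   = upward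
      }
      where
      ⊙-closed : ∀ {x y} → x ∈ ⋃ → y ∈ ⋃ → x ⊙ y ∈ ⋃
      ⊙-closed (inj₁ x∈⋃C) (inj₁ y∈⋃C) with fromSmall x∈⋃C | fromSmall y∈⋃C
      ... | F , F∈C , x∈F | G , G∈C , y∈G with chain F∈C G∈C
      ... | inj₁ F≼G = inj₁ (toSmall (G , G∈C , IsFilter.⊙-closed (isFilter G) (F≼G x∈F) y∈G))
      ... | inj₂ G≼F = inj₁ (toSmall (F , F∈C , IsFilter.⊙-closed (isFilter F) x∈F (G≼F y∈G)))
      ⊙-closed {x} x∈⋃ (inj₂ refl) = subst ⋃ (sym (identityʳ x)) x∈⋃
      ⊙-closed {y = y} (inj₂ refl) y∈⋃ = subst ⋃ (sym (identityˡ y)) y∈⋃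

      upward : ∀ {x y} → x ∈ ⋃ → x ≤ y → y ∈ ⋃
      upward (inj₁ x∈⋃C) x≤y with fromSmall x∈⋃C
      ... | F , F∈C , x∈F = inj₁ (toSmall (F , F∈C , IsFilter.upward (isFilter F) x∈F x≤y))
      upward {y = y} (inj₂ refl) 𝟙≤y = inj₂ (≤-antisym (𝟙-greatest y) 𝟙≤y)

    ⋃-avoids : t ≢ 𝟙 → t ∉ ⋃
    ⋃-avoids _ (inj₁ t∈⋃C) with fromSmall t∈⋃C
    ... | F , _ , t∈F = avoids F t∈F
    ⋃-avoids t≢𝟙 (inj₂ t≡𝟙) = t≢𝟙 t≡𝟙

  maximalAvoiding-exists : ZornsLemma (lsuc a) a (lsuc a) → t ≢ 𝟙 → ∃[ P ] IsMaximalAvoiding t P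
  maximalAvoiding-exists {t} zorn t≢𝟙 =
    let P , P-maximal = zorn (AvoidingFilter t) _≼_ (λ _ x∈F → x∈F)
                          (λ F≼G G≼H x∈F → G≼H (F≼G x∈F)) upperBound
    in carrier P , isFilter P , avoids P ,
       λ G G-filter t∉G P⊆G →
         P-maximal (record { carrier = G ; isFilter = G-filter ; avoids = t∉G }) P⊆G
    where
    upperBound : ∀ C → IsChain C → ∃[ U ] (∀ {F} → F ∈ C → F ≼ U)
    upperBound C chain =
      record { carrier = ⋃ C chain ; isFilter = ⋃-isFilter C chain ; avoids = ⋃-avoids C chain t≢𝟙 } ,
      λ F∈C x∈F → inj₁ (toSmall (_ , F∈C , x∈F))

  simple⇒nontrivialElement : IsSimpleFilter L T → ∃[ t ] t ∈ T × t ≢ 𝟙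
  simple⇒nontrivialElement {T} (T-filter , T-nontrivial , _) = dne λ ∄t → T-nontrivial λ x →
    (λ x∈T → dne λ x≢𝟙 → ∄t (x , x∈T , x≢𝟙)) ,
    λ x≡𝟙 → subst T (sym x≡𝟙) (𝟙∈filter T-filter)

  radTrivial⇒maximalAvoiding : RadIsTrivial L → t ≢ 𝟙 → ∃[ M ] IsMaximalFilter L M × t ∉ M
  radTrivial⇒maximalAvoiding {t} rad-trivial t≢𝟙 = dne λ ∄M →
    t≢𝟙 (proj₁ (rad-trivial t) λ M M-maximal → dne λ t∉M → ∄M (M , M-maximal , t∉M))

  maximal-joinIsWhole : IsMaximalFilter L M → t ∈ F → t ∉ M → JoinIsWhole L F M
  maximal-joinIsWhole (_ , maximal) t∈F t∉M K K-filter F⊆K M⊆K =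
    dne λ K-notWhole → t∉M (maximal K (K-filter , K-notWhole) M⊆K (F⊆K t∈F))

proposition3p10 : (lem : ∀ {ℓ} → ExcludedMiddle ℓ)
    → (zorn : ∀ {ℓ₁ ℓ₂ ℓ₃} → ZornsLemma ℓ₁ ℓ₂ ℓ₃)
    → ∀ {a : Level} (L : ResiduatedLattice a) (T : Subset L)
    → IsSimpleFilter L T
    → (∃ λ (P : Subset L) → IsPrimeFilter L P × MeetIsTrivial L T P)
    × (RadIsTrivial L → ∃ λ (G : Subset L) → IsFilter L G × DirectSum L T G)
proposition3p10 lem zorn L T T-simple =
  let t , t∈T , t≢𝟙 = simple⇒nontrivialElement T-simple
      P , P-maximalAvoiding@(P-filter , t∉P , _) = maximalAvoiding-exists zorn t≢𝟙
  in (P , maximalAvoiding⇒prime P-maximalAvoiding , simple-meet-avoiding T-simple t∈T P-filter t∉P) ,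
     λ rad-trivial →
       let M , M-maximal@((M-filter , _) , _) , t∉M = radTrivial⇒maximalAvoiding rad-trivial t≢𝟙
       in M , M-filter , simple-meet-avoiding T-simple t∈T M-filter t∉M ,
          maximal-joinIsWhole M-maximal t∈T t∉M
  where
  open Properties L
  open Classical lem L
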